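{- Let $G$ and $H$ be finite simple graphs without isolated vertices and let $g=(V'_0,V'_1,V'_2)$ be a $\gamma_{tR}(G\times H)$-function. Then $$\gamma_{tR}(G\times H)\ge |V(G)||V(H)|-(\Delta(G)\Delta(H)-2)|V'_2|\quad\text{and}\quad |V'_2|\ge \frac{|V(G)||V(H)|-|V'_1|}{\Delta(G)\Delta(H)}.$$ Moreover, if $|V(G)||V(H)|=\Delta(G)\Delta(H)|V'_2|+|V'_1|$, then $\gamma_{tR}(G\times H)=|V(G)||V(H)|-(\Delta(G)\Delta(H)-2)|V'_2|$.
   Context: $\Delta(G)$ is the maximum degree of $G$. A function $f:V(G)\to\{0,1,2\}$ with $V_i=f^{ -1}(i)$ is a total Roman dominating function if every vertex in $V_0$ has a neighbor in $V_2$ and the subgraph induced by $V_1\cup V_2$ has no isolated vertices; $\gamma_{tR}(G)$ is the minimum of $\sum_v f(v)$ over such $f$, and a $\gamma_{tR}(G)$-function is one attaining this minimum. The direct product $G\times H$ has vertex set $V(G)\times V(H)$, with $(g,h)(g',h')$ an edge iff $gg'\in E(G)$ and $hh'\in E(H)$. -}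

module Defs where

open import Data.Nat using (ℕ; zero; suc; _+_; _*_; _⊔_; _≤_)
open import Data.Bool using (Bool; true; false; _∧_; if_then_else_)
open import Data.Bool.Properties using (∧-comm)
open import Data.Fin using (Fin; toℕ; remQuot; _≟_) renaming (zero to 0F; suc to sF)
open import Data.List using (List; map; foldr; allFin)
open import Data.Nat.ListAction using (sum)
open import Data.Product using (Σ; ∃; _×_; _,_; proj₁; proj₂)
open import Relation.Nullary using (¬_)
open import Relation.Nullary.Decidable using (⌊_⌋)
open import Relation.Binary.PropositionalEquality using (_≡_; refl; cong₂)

record Graph : Set where
  field
    n      : ℕ
    Adj    : Fin n → Fin n → Bool
    sym    : ∀ u v → Adj u v ≡ Adj v u
    irrefl : ∀ v → Adj v v ≡ false
open Graph public

order : Graph → ℕ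
order G = n G

count : ∀ {k} → (Fin k → Bool) → ℕ
count {k} p = sum (map (λ v → if p v then 1 else 0) (allFin k))

deg : (G : Graph) → Fin (n G) → ℕ
deg G v = count (Adj G v)

-- maximum degree Δ(G) (0 for the empty graph)
Δ : Graph → ℕ
Δ G = foldr _⊔_ 0 (map (deg G) (allFin (n G)))

NoIsolated : Graph → Set
NoIsolated G = ∀ v → ∃ λ u → Adj G v u ≡ true

-- direct (tensor) product G × H, vertex (g,h) encoded as Fin (n G * n H)
-- via remQuot (a bijection Fin (a*b) ≅ Fin a × Fin b).
_⊗_ : Graph → Graph → Graph
G ⊗ H = record
  { n = n G * n H
  ; Adj = λ x y → let (g , h) = remQuot {n G} (n H) x
                      (g′ , h′) = remQuot {n G} (n H) y
                  in Adj G g g′ ∧ Adj H h h′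
  ; sym = λ x y → cong₂ _∧_ (sym G _ _) (sym H _ _)
  ; irrefl = λ x → lemma (Adj H _ _) (irrefl G _)
  }
  where
  lemma : ∀ b {a} → a ≡ false → (a ∧ b) ≡ false
  lemma b refl = refl

1F 2F : Fin 3
1F = sF 0F
2F = sF (sF 0F)

IsTRDF : (G : Graph) → (Fin (n G) → Fin 3) → Set
IsTRDF G f =
  (∀ v → f v ≡ 0F → ∃ λ u → Adj G v u ≡ true × f u ≡ 2F)
  × (∀ v → ¬ (f v ≡ 0F) → ∃ λ u → Adj G v u ≡ true × ¬ (f u ≡ 0F))

weight : (G : Graph) → (Fin (n G) → Fin 3) → ℕ
weight G f = sum (map (λ v → toℕ (f v)) (allFin (n G)))

IsγtRFunction : (G : Graph) → (Fin (n G) → Fin 3) → Set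
IsγtRFunction G f = IsTRDF G f × (∀ h → IsTRDF G h → weight G f ≤ weight G h)

classSize : (G : Graph) → (Fin (n G) → Fin 3) → Fin 3 → ℕ
classSize G f i = count (λ v → ⌊ f v ≟ i ⌋)

-- The corollary is an instance of a counting argument that works in any
-- graph K whose degrees are bounded by some D, for any total Roman
-- dominating function f.  Write
-- Vᵢ = f⁻¹(i).  Every vertex of V₀ has a neighbour in V₂, so |V₀| is at
-- most the number of V₂–V₀ edges.  A vertex of V₂ has a neighbour outside
-- V₀, so it has at most D - 1 neighbours in V₀.  Hence
--   |V₀| + |V₂| ≤ D·|V₂|,  i.e.  |V(K)| ≤ D·|V₂| + |V₁|,
-- and since w(f) = |V₁| + 2|V₂| = |V(K)| - (D - 2)|V₂| + slack, where the
-- slack is D·|V₂| + |V₁| - |V(K)| ≥ 0, both inequalities and the equality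
-- case follow.  For K = G × H one has deg(g,h) = deg g · deg h, so
-- D = Δ(G)Δ(H) bounds every degree.
module Submission where

open import Defs renaming (sym to adj-sym)
open import Data.Nat using (ℕ; zero; suc; _+_; _*_; _∸_; _⊔_; _≤_; z≤n)
open import Data.Nat.Properties using (+-*-semiring; +-comm; +-assoc; +-identityʳ; *-identityˡ; *-identityʳ; *-distribˡ-+; *-suc; ≤-refl; ≤-trans; +-mono-≤; +-monoʳ-≤; *-mono-≤; m≤m+n; m≤n+m; m≤n⇒m≤n⊔o; m≤n⇒m≤o⊔n; m+[n∸m]≡n; module ≤-Reasoning)
open import Data.Integer using (ℤ; +_; _-_; _≥_) renaming (_*_ to _*ℤ_; _+_ to _+ℤ_; _≤_ to _≤ℤ_)
import Data.Integer.Properties as ℤ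
open import Data.Integer.Tactic.RingSolver using (solve-∀)
open import Data.Fin using (Fin; toℕ; _↑ˡ_; _↑ʳ_; remQuot; combine; _≟_) renaming (zero to 0F; suc to sF)
open import Data.Fin.Properties using (remQuot-combine)
open import Data.Bool using (Bool; true; false; _∧_; if_then_else_)
open import Data.List using (map; allFin; tabulate)
open import Data.List.Properties using (map-tabulate; foldr-preservesᵒ)
open import Data.List.Membership.Propositional.Properties using (∈-allFin)
import Data.List.Relation.Unary.Any as Any
import Data.List.Relation.Unary.Any.Properties as Any
open import Data.Nat.ListAction using (sum)
open import Data.Product using (∃; _×_; _,_; proj₁; proj₂)
open import Data.Sum using (_⊎_; inj₂; [_,_])
open import Data.Empty using (⊥-elim)
open import Relation.Nullary using (¬_)
open import Relation.Nullary.Decidable using (⌊_⌋)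
open import Relation.Binary.PropositionalEquality using (_≡_; refl; sym; trans; cong; cong₂; subst; subst₂; module ≡-Reasoning)
open import Algebra.Properties.Semiring.Sum +-*-semiring using (sum-syntax; sum-cong-≗; ∑-distrib-+; ∑-comm; *-distribˡ-sum; *-distribʳ-sum)

b2n : Bool → ℕ
b2n b = if b then 1 else 0

b2n-∧ : ∀ a b → b2n (a ∧ b) ≡ b2n a * b2n b
b2n-∧ true  b = sym (+-identityʳ (b2n b))
b2n-∧ false b = refl

sum-tabulate : ∀ k (f : Fin k → ℕ) → sum (tabulate f) ≡ ∑[ i < k ] f i
sum-tabulate zero    f = refl
sum-tabulate (suc k) f = cong (_+_ (f 0F)) (sum-tabulate k (λ i → f (sF i)))

sum-allFin : ∀ k (f : Fin k → ℕ) → sum (map f (allFin k)) ≡ ∑[ i < k ] f i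
sum-allFin k f = trans (cong sum (map-tabulate (λ i → i) f)) (sum-tabulate k f)

count-∑ : ∀ {k} (p : Fin k → Bool) → count p ≡ ∑[ i < k ] b2n (p i)
count-∑ {k} p = sum-allFin k (λ i → b2n (p i))

∑-mono-≤ : ∀ k {f g : Fin k → ℕ} → (∀ i → f i ≤ g i) → ∑[ i < k ] f i ≤ ∑[ i < k ] g i
∑-mono-≤ zero    f≤g = z≤n
∑-mono-≤ (suc k) f≤g = +-mono-≤ (f≤g 0F) (∑-mono-≤ k (λ i → f≤g (sF i)))

term≤∑ : ∀ k (f : Fin k → ℕ) i → f i ≤ ∑[ j < k ] f j
term≤∑ (suc k) f 0F     = m≤m+n (f 0F) _
term≤∑ (suc k) f (sF i) = ≤-trans (term≤∑ k (λ j → f (sF j)) i) (m≤n+m _ (f 0F))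

∑-ones : ∀ k → ∑[ i < k ] 1 ≡ k
∑-ones zero    = refl
∑-ones (suc k) = cong suc (∑-ones k)

∑-++ : ∀ a b (f : Fin (a + b) → ℕ) →
       ∑[ i < a + b ] f i ≡ ∑[ i < a ] f (i ↑ˡ b) + ∑[ j < b ] f (a ↑ʳ j)
∑-++ zero    b f = refl
∑-++ (suc a) b f =
  trans (cong (_+_ (f 0F)) (∑-++ a b (λ i → f (sF i)))) (sym (+-assoc (f 0F) _ _))

∑-combine : ∀ m n (f : Fin (m * n) → ℕ) →
            ∑[ u < m * n ] f u ≡ ∑[ i < m ] ∑[ j < n ] f (combine i j)
∑-combine zero    n f = refl
∑-combine (suc m) n f =
  trans (∑-++ n (m * n) f) (cong (_+_ _) (∑-combine m n (λ u → f (n ↑ʳ u))))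

deg-∑ : ∀ G v → deg G v ≡ ∑[ u < n G ] b2n (Adj G v u)
deg-∑ G v = count-∑ (Adj G v)

-- Δ is an upper bound of all degrees: a lower bound of one element of a
-- list is a lower bound of its ⊔-fold.
deg≤Δ : ∀ G v → deg G v ≤ Δ G
deg≤Δ G v = foldr-preservesᵒ ≤-⊔ 0 (map (deg G) (allFin (n G)))
              (inj₂ (Any.map⁺ (Any.map (λ { refl → ≤-refl }) (∈-allFin v))))
  where
  ≤-⊔ : ∀ x y → deg G v ≤ x ⊎ deg G v ≤ y → deg G v ≤ x ⊔ y
  ≤-⊔ x y = [ m≤n⇒m≤n⊔o y , m≤n⇒m≤o⊔n x ]

deg-⊗ : ∀ G H x → let (g , h) = remQuot {n G} (n H) x in
        deg (G ⊗ H) x ≡ deg G g * deg H h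
deg-⊗ G H x = begin
  deg (G ⊗ H) x
    ≡⟨ deg-∑ (G ⊗ H) x ⟩
  ∑[ u < n G * n H ] b2n (adj× (remQuot (n H) u))
    ≡⟨ ∑-combine (n G) (n H) _ ⟩
  ∑[ i < n G ] ∑[ j < n H ] b2n (adj× (remQuot (n H) (combine i j)))
    ≡⟨ sum-cong-≗ (λ i → sum-cong-≗ (λ j → adj-factor i j)) ⟩
  ∑[ i < n G ] ∑[ j < n H ] (b2n (Adj G g i) * b2n (Adj H h j))
    ≡⟨ sum-cong-≗ (λ i → sym (*-distribˡ-sum {n H} (b2n (Adj G g i)) _)) ⟩
  ∑[ i < n G ] (b2n (Adj G g i) * ∑[ j < n H ] b2n (Adj H h j))
    ≡⟨ sym (*-distribʳ-sum _ (λ i → b2n (Adj G g i))) ⟩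
  (∑[ i < n G ] b2n (Adj G g i)) * ∑[ j < n H ] b2n (Adj H h j)
    ≡⟨ sym (cong₂ _*_ (deg-∑ G g) (deg-∑ H h)) ⟩
  deg G g * deg H h ∎
  where
  open ≡-Reasoning
  g = proj₁ (remQuot {n G} (n H) x)
  h = proj₂ (remQuot {n G} (n H) x)
  adj× : Fin (n G) × Fin (n H) → Bool
  adj× (i , j) = Adj G g i ∧ Adj H h j
  adj-factor : ∀ i j → b2n (adj× (remQuot (n H) (combine i j))) ≡ b2n (Adj G g i) * b2n (Adj H h j)
  adj-factor i j = trans (cong (λ p → b2n (adj× p)) (remQuot-combine i j)) (b2n-∧ (Adj G g i) (Adj H h j))

deg-⊗-≤ : ∀ G H x → deg (G ⊗ H) x ≤ Δ G * Δ H
deg-⊗-≤ G H x = subst (_≤ Δ G * Δ H) (sym (deg-⊗ G H x))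
                  (*-mono-≤ (deg≤Δ G _) (deg≤Δ H _))

χ : Fin 3 → Fin 3 → ℕ
χ i x = b2n ⌊ x ≟ i ⌋

χ-partition : ∀ x → χ 0F x + (χ 1F x + χ 2F x) ≡ 1
χ-partition 0F           = refl
χ-partition (sF 0F)      = refl
χ-partition (sF (sF 0F)) = refl

χ-weight : ∀ x → toℕ x ≡ χ 1F x + 2 * χ 2F x
χ-weight 0F           = refl
χ-weight (sF 0F)      = refl
χ-weight (sF (sF 0F)) = refl

module TRDFCounting (K : Graph) (f : Fin (n K) → Fin 3) (trdf : IsTRDF K f) where

  size : Fin 3 → ℕ
  size i = ∑[ v < n K ] χ i (f v)

  adj : Fin (n K) → Fin (n K) → ℕ
  adj v u = b2n (Adj K v u)

  nbrs₀ nbrs₊ : Fin (n K) → ℕ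
  nbrs₀ v = ∑[ u < n K ] (adj v u * χ 0F (f u))
  nbrs₊ v = ∑[ u < n K ] (adj v u * (χ 1F (f u) + χ 2F (f u)))

  classSize-size : ∀ i → classSize K f i ≡ size i
  classSize-size i = count-∑ (λ v → ⌊ f v ≟ i ⌋)

  weight-size : weight K f ≡ size 1F + 2 * size 2F
  weight-size = begin
    weight K f                                   ≡⟨ sum-allFin (n K) (λ v → toℕ (f v)) ⟩
    ∑[ v < n K ] toℕ (f v)                       ≡⟨ sum-cong-≗ (λ v → χ-weight (f v)) ⟩
    ∑[ v < n K ] (χ 1F (f v) + 2 * χ 2F (f v))   ≡⟨ ∑-distrib-+ (λ v → χ 1F (f v)) _ ⟩
    size 1F + ∑[ v < n K ] (2 * χ 2F (f v))      ≡⟨ cong (_+_ (size 1F)) (sym (*-distribˡ-sum {n K} 2 _)) ⟩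
    size 1F + 2 * size 2F                        ∎
    where open ≡-Reasoning

  order-size : n K ≡ size 0F + (size 1F + size 2F)
  order-size = begin
    n K                                                 ≡⟨ sym (∑-ones (n K)) ⟩
    ∑[ v < n K ] 1                                      ≡⟨ sum-cong-≗ (λ v → sym (χ-partition (f v))) ⟩
    ∑[ v < n K ] (χ 0F (f v) + (χ 1F (f v) + χ 2F (f v))) ≡⟨ ∑-distrib-+ (λ v → χ 0F (f v)) _ ⟩
    size 0F + ∑[ v < n K ] (χ 1F (f v) + χ 2F (f v))    ≡⟨ cong (_+_ (size 0F)) (∑-distrib-+ (λ v → χ 1F (f v)) _) ⟩
    size 0F + (size 1F + size 2F)                       ∎
    where open ≡-Reasoning

  deg-split : ∀ v → deg K v ≡ nbrs₀ v + nbrs₊ v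
  deg-split v = begin
    deg K v                    ≡⟨ deg-∑ K v ⟩
    ∑[ u < n K ] adj v u       ≡⟨ sum-cong-≗ split-term ⟩
    ∑[ u < n K ] (adj v u * χ 0F (f u) + adj v u * (χ 1F (f u) + χ 2F (f u)))
                               ≡⟨ ∑-distrib-+ (λ u → adj v u * χ 0F (f u)) _ ⟩
    nbrs₀ v + nbrs₊ v ∎
    where
    open ≡-Reasoning
    split-term : ∀ u → adj v u ≡ adj v u * χ 0F (f u) + adj v u * (χ 1F (f u) + χ 2F (f u))
    split-term u = begin
      adj v u                                          ≡⟨ sym (*-identityʳ _) ⟩
      adj v u * 1                                      ≡⟨ cong (adj v u *_) (sym (χ-partition (f u))) ⟩
      adj v u * (χ 0F (f u) + (χ 1F (f u) + χ 2F (f u))) ≡⟨ *-distribˡ-+ (adj v u) _ _ ⟩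
      adj v u * χ 0F (f u) + adj v u * (χ 1F (f u) + χ 2F (f u)) ∎

  -- A vertex outside V₀ has a neighbour outside V₀ (V₁ ∪ V₂ has no
  -- isolated vertex), so it has at most deg v - 1 neighbours in V₀.
  positive-deg : ∀ v → ¬ f v ≡ 0F → suc (nbrs₀ v) ≤ deg K v
  positive-deg v fv≢0 = begin
    suc (nbrs₀ v)      ≡⟨ +-comm 1 _ ⟩
    nbrs₀ v + 1        ≤⟨ +-monoʳ-≤ (nbrs₀ v) (one-positive (proj₂ trdf v fv≢0)) ⟩
    nbrs₀ v + nbrs₊ v  ≡⟨ sym (deg-split v) ⟩
    deg K v            ∎
    where
    open ≤-Reasoning
    one-positive : (∃ λ w → Adj K v w ≡ true × ¬ f w ≡ 0F) → 1 ≤ nbrs₊ v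
    one-positive (w , vw , fw≢0) = ≤-trans w-positive (term≤∑ (n K) _ w)
      where
      w-positive : 1 ≤ adj v w * (χ 1F (f w) + χ 2F (f w))
      w-positive rewrite vw with f w
      ... | 0F         = ⊥-elim (fw≢0 refl)
      ... | sF 0F      = ≤-refl
      ... | sF (sF 0F) = ≤-refl

  -- A vertex u ∈ V₀ has a neighbour v ∈ V₂, so it is counted at least
  -- once among the edges between V₂ and V₀.
  dominated : ∀ u → χ 0F (f u) ≤ ∑[ v < n K ] (χ 2F (f v) * (adj v u * χ 0F (f u)))
  dominated u with f u in fu≡
  ... | sF 0F      = z≤n
  ... | sF (sF 0F) = z≤n
  ... | 0F         = ≤-trans (edge (proj₁ trdf u fu≡)) (term≤∑ (n K) _ _)
    where
    edge : (p : ∃ λ w → Adj K u w ≡ true × f w ≡ 2F) → 1 ≤ χ 2F (f (proj₁ p)) * (adj (proj₁ p) u * 1)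
    edge (w , uw , fw≡2) rewrite fw≡2 | adj-sym K w u | uw = ≤-refl

  V₀-bound : size 0F ≤ ∑[ v < n K ] (χ 2F (f v) * nbrs₀ v)
  V₀-bound = begin
    size 0F
      ≤⟨ ∑-mono-≤ (n K) dominated ⟩
    ∑[ u < n K ] ∑[ v < n K ] (χ 2F (f v) * (adj v u * χ 0F (f u)))
      ≡⟨ ∑-comm (λ u v → χ 2F (f v) * (adj v u * χ 0F (f u))) ⟩
    ∑[ v < n K ] ∑[ u < n K ] (χ 2F (f v) * (adj v u * χ 0F (f u)))
      ≡⟨ sum-cong-≗ (λ v → sym (*-distribˡ-sum {n K} (χ 2F (f v)) _)) ⟩
    ∑[ v < n K ] (χ 2F (f v) * nbrs₀ v) ∎
    where open ≤-Reasoning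

  module _ (D : ℕ) (deg≤D : ∀ v → deg K v ≤ D) where

    V₂-vertex-bound : ∀ v → χ 2F (f v) * suc (nbrs₀ v) ≤ D * χ 2F (f v)
    V₂-vertex-bound v with f v in fv≡
    ... | 0F         = z≤n
    ... | sF 0F      = z≤n
    ... | sF (sF 0F) = subst₂ _≤_ (sym (*-identityˡ _)) (sym (*-identityʳ D))
                         (≤-trans (positive-deg v (λ fv≡0 → 2≢0 (trans (sym fv≡) fv≡0))) (deg≤D v))
      where
      2≢0 : ¬ (2F ≡ 0F)
      2≢0 ()

    V₂+V₀-bound : size 2F + size 0F ≤ D * size 2F
    V₂+V₀-bound = begin
      size 2F + size 0F
        ≤⟨ +-monoʳ-≤ (size 2F) V₀-bound ⟩
      size 2F + ∑[ v < n K ] (χ 2F (f v) * nbrs₀ v)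
        ≡⟨ sym (∑-distrib-+ (λ v → χ 2F (f v)) _) ⟩
      ∑[ v < n K ] (χ 2F (f v) + χ 2F (f v) * nbrs₀ v)
        ≡⟨ sum-cong-≗ (λ v → sym (*-suc (χ 2F (f v)) _)) ⟩
      ∑[ v < n K ] (χ 2F (f v) * suc (nbrs₀ v))
        ≤⟨ ∑-mono-≤ (n K) V₂-vertex-bound ⟩
      ∑[ v < n K ] (D * χ 2F (f v))
        ≡⟨ sym (*-distribˡ-sum {n K} D _) ⟩
      D * size 2F ∎
      where open ≤-Reasoning

    order-bound : n K ≤ D * size 2F + size 1F
    order-bound = begin
      n K                             ≡⟨ order-size ⟩
      size 0F + (size 1F + size 2F)   ≡⟨ +-comm (size 0F) _ ⟩
      (size 1F + size 2F) + size 0F   ≡⟨ +-assoc (size 1F) _ _ ⟩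
      size 1F + (size 2F + size 0F)   ≤⟨ +-monoʳ-≤ (size 1F) V₂+V₀-bound ⟩
      size 1F + D * size 2F           ≡⟨ +-comm (size 1F) _ ⟩
      D * size 2F + size 1F           ∎
      where open ≤-Reasoning

weight-slack : ∀ N D c₁ c₂ s → N + s ≡ D * c₂ + c₁ →
               + (c₁ + 2 * c₂) ≡ (+ N - (+ D - + 2) *ℤ + c₂) +ℤ + s
weight-slack N D c₁ c₂ s N+s≡ = begin
  + (c₁ + 2 * c₂)
    ≡⟨ trans (ℤ.pos-+ c₁ (2 * c₂)) (cong (_+ℤ_ (+ c₁)) (ℤ.pos-* 2 c₂)) ⟩
  + c₁ +ℤ + 2 *ℤ + c₂
    ≡⟨ regroup-weight (+ D) (+ c₁) (+ c₂) ⟩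
  (+ D *ℤ + c₂ +ℤ + c₁) - (+ D - + 2) *ℤ + c₂
    ≡⟨ cong (λ z → z - (+ D - + 2) *ℤ + c₂) (sym cast-hyp) ⟩
  (+ N +ℤ + s) - (+ D - + 2) *ℤ + c₂
    ≡⟨ regroup-slack (+ N) (+ D) (+ c₂) (+ s) ⟩
  (+ N - (+ D - + 2) *ℤ + c₂) +ℤ + s ∎
  where
  open ≡-Reasoning
  regroup-weight : ∀ (d a c : ℤ) → a +ℤ + 2 *ℤ c ≡ (d *ℤ c +ℤ a) - (d - + 2) *ℤ c
  regroup-weight = solve-∀
  regroup-slack : ∀ (m d c t : ℤ) → (m +ℤ t) - (d - + 2) *ℤ c ≡ (m - (d - + 2) *ℤ c) +ℤ t
  regroup-slack = solve-∀
  cast-hyp : + N +ℤ + s ≡ + D *ℤ + c₂ +ℤ + c₁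
  cast-hyp = begin
    + N +ℤ + s           ≡⟨ sym (ℤ.pos-+ N s) ⟩
    + (N + s)            ≡⟨ cong +_ N+s≡ ⟩
    + (D * c₂ + c₁)      ≡⟨ trans (ℤ.pos-+ (D * c₂) c₁) (cong (_+ℤ + c₁) (ℤ.pos-* D c₂)) ⟩
    + D *ℤ + c₂ +ℤ + c₁  ∎

trdf-bounds : (K : Graph) (D : ℕ) → (∀ v → deg K v ≤ D) →
  (f : Fin (n K) → Fin 3) → IsTRDF K f →
  (+ weight K f ≥ + n K - (+ D - + 2) *ℤ + classSize K f 2F)
  × (n K ≤ D * classSize K f 2F + classSize K f 1F)
  × (n K ≡ D * classSize K f 2F + classSize K f 1F →
     + weight K f ≡ + n K - (+ D - + 2) *ℤ + classSize K f 2F)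
trdf-bounds K D deg≤D f trdf
  rewrite TRDFCounting.weight-size K f trdf
        | TRDFCounting.classSize-size K f trdf 1F
        | TRDFCounting.classSize-size K f trdf 2F =
    subst (lower ≤ℤ_) (sym (weight-with-slack slack (m+[n∸m]≡n bound))) (ℤ.i≤i+j lower (+ slack))
  , bound
  , λ tight → trans (weight-with-slack 0 (trans (+-identityʳ (n K)) tight)) (ℤ.+-identityʳ lower)
  where
  open TRDFCounting K f trdf
  bound : n K ≤ D * size 2F + size 1F
  bound = order-bound D deg≤D
  lower : ℤ
  lower = + n K - (+ D - + 2) *ℤ + size 2F
  slack : ℕ
  slack = D * size 2F + size 1F ∸ n K
  weight-with-slack : ∀ s → n K + s ≡ D * size 2F + size 1F →
                      + (size 1F + 2 * size 2F) ≡ lower +ℤ + s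
  weight-with-slack = weight-slack (n K) D (size 1F) (size 2F)

corollary14 : (G H : Graph) → NoIsolated G → NoIsolated H →
    (g : Fin (n (G ⊗ H)) → Fin 3) → IsγtRFunction (G ⊗ H) g →
    ((+ weight (G ⊗ H) g) ≥ (+ (order G * order H)) - ((+ (Δ G * Δ H)) - + 2) *ℤ (+ classSize (G ⊗ H) g 2F))
    × (order G * order H ≤ Δ G * Δ H * classSize (G ⊗ H) g 2F + classSize (G ⊗ H) g 1F)
    × (order G * order H ≡ Δ G * Δ H * classSize (G ⊗ H) g 2F + classSize (G ⊗ H) g 1F →
       + weight (G ⊗ H) g ≡ (+ (order G * order H)) - ((+ (Δ G * Δ H)) - + 2) *ℤ (+ classSize (G ⊗ H) g 2F))
corollary14 G H _ _ g (g-trdf , _) = trdf-bounds (G ⊗ H) (Δ G * Δ H) (deg-⊗-≤ G H) g g-trdf
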